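{- Let $-\ltimes U:\mathcal W\to\mathcal V$ be a multiplier for $U\in\mathcal V$. Then: (1) if $\varphi\circ\chi$ is dimensionally split (with codomain $U$), then so is $\varphi$; (2) $\mathrm{id}_U$ is dimensionally split; (3) if $\varphi:V\to U$ is dimensionally split and $\chi:V'\to V$ is split epi, then $\varphi\circ\chi$ is dimensionally split; (4) every split epimorphism with codomain $U$ is dimensionally split; (5) if the multiplier is non-spooky, every dimensionally split morphism is split epi.
   Context: $\mathcal W$ has a terminal object $\top$. A multiplier for $U$ is a functor $-\ltimes U:\mathcal W\to\mathcal V$ with an isomorphism $\top\ltimes U\cong U$; $\pi_2:W\ltimes U\to U$ is $(!_W\ltimes U)$ followed by it. A morphism $\varphi:V\to U$ is dimensionally split if there exist $W\in\mathcal W$ and $\chi:W\ltimes U\to V$ with $\varphi\circ\chi=\pi_2$. The multiplier is non-spooky if every $\pi_2:W\ltimes U\to U$ is split epi. -}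

module Defs where

open import Level using (Level; _⊔_; suc)
open import Relation.Binary.Structures using (IsEquivalence)
open import Data.Product using (Σ; ∃; _×_; _,_)

record Category (o ℓ e : Level) : Set (suc (o ⊔ ℓ ⊔ e)) where
  infix  4 _≈_
  infixr 9 _∘_
  field
    Obj : Set o
    Hom : Obj → Obj → Set ℓ
    _≈_ : ∀ {A B} → Hom A B → Hom A B → Set e
    id  : ∀ {A} → Hom A A
    _∘_ : ∀ {A B C} → Hom B C → Hom A B → Hom A C
    assoc     : ∀ {A B C D} {f : Hom A B} {g : Hom B C} {h : Hom C D} →
                (h ∘ g) ∘ f ≈ h ∘ (g ∘ f)
    identityˡ : ∀ {A B} {f : Hom A B} → id ∘ f ≈ f
    identityʳ : ∀ {A B} {f : Hom A B} → f ∘ id ≈ f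
    equiv     : ∀ {A B} → IsEquivalence (_≈_ {A} {B})
    ∘-resp-≈  : ∀ {A B C} {f h : Hom B C} {g i : Hom A B} →
                f ≈ h → g ≈ i → f ∘ g ≈ h ∘ i

record Functor {o ℓ e o′ ℓ′ e′ : Level}
               (C : Category o ℓ e) (D : Category o′ ℓ′ e′)
               : Set (o ⊔ ℓ ⊔ e ⊔ o′ ⊔ ℓ′ ⊔ e′) where
  private
    module C = Category C
    module D = Category D
  field
    F₀ : C.Obj → D.Obj
    F₁ : ∀ {A B} → C.Hom A B → D.Hom (F₀ A) (F₀ B)
    identity     : ∀ {A} → F₁ (C.id {A}) D.≈ D.id
    homomorphism : ∀ {A B C′} {f : C.Hom A B} {g : C.Hom B C′} →
                   F₁ (g C.∘ f) D.≈ F₁ g D.∘ F₁ f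
    F-resp-≈     : ∀ {A B} {f g : C.Hom A B} → f C.≈ g → F₁ f D.≈ F₁ g

module _ {o ℓ e : Level} (C : Category o ℓ e) where
  open Category C

  record Terminal : Set (o ⊔ ℓ ⊔ e) where
    field
      ⊤  : Obj
      !  : ∀ {A} → Hom A ⊤
      !-unique : ∀ {A} (f : Hom A ⊤) → ! ≈ f

  record Iso (A B : Obj) : Set (ℓ ⊔ e) where
    field
      from : Hom A B
      to   : Hom B A
      isoˡ : to ∘ from ≈ id
      isoʳ : from ∘ to ≈ id

  SplitEpi : ∀ {A B} → Hom A B → Set (ℓ ⊔ e)
  SplitEpi {A} {B} f = Σ (Hom B A) λ s → f ∘ s ≈ id

module _ {o ℓ e o′ ℓ′ e′ : Level}
         (W : Category o ℓ e) (V : Category o′ ℓ′ e′) (T : Terminal W) where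
  private
    module W = Category W
    module V = Category V
  open Terminal T

  record Multiplier (U : V.Obj) : Set (o ⊔ ℓ ⊔ e ⊔ o′ ⊔ ℓ′ ⊔ e′) where
    field
      ⋉U   : Functor W V
      unit : Iso V (Functor.F₀ ⋉U ⊤) U
    open Functor ⋉U public

    π₂ : (X : W.Obj) → V.Hom (F₀ X) U
    π₂ X = Iso.from unit V.∘ F₁ (! {X})

    DimSplit : ∀ {A} → V.Hom A U → Set (o ⊔ ℓ′ ⊔ e′)
    DimSplit {A} φ = Σ W.Obj λ X → Σ (V.Hom (F₀ X) A) λ χ → (φ V.∘ χ) V.≈ π₂ X

    NonSpooky : Set (o ⊔ ℓ′ ⊔ e′)
    NonSpooky = (X : W.Obj) → SplitEpi V (π₂ X)

module Submission where

open import Defs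
open import Level using (Level)
open import Data.Product using (_×_; _,_)
open import Relation.Binary.Bundles using (Setoid)
import Relation.Binary.Reasoning.Setoid as SetoidReasoning

module _ {o ℓ e : Level} (C : Category o ℓ e) where
  open Category C

  hom-setoid : Obj → Obj → Setoid ℓ e
  hom-setoid A B = record { _≈_ = _≈_ {A} {B} ; isEquivalence = equiv }

  module HomReasoning {A B : Obj} = SetoidReasoning (hom-setoid A B)
  private
    module Hom {A B} = Setoid (hom-setoid A B)

  cancel-section : ∀ {A B D} {f : Hom A B} {s : Hom B A} (g : Hom D B) →
                   f ∘ s ≈ id → f ∘ (s ∘ g) ≈ g
  cancel-section {f = f} {s} g fs≈id = begin
    f ∘ (s ∘ g)  ≈⟨ Hom.sym assoc ⟩
    (f ∘ s) ∘ g  ≈⟨ ∘-resp-≈ fs≈id Hom.refl ⟩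
    id ∘ g       ≈⟨ identityˡ ⟩
    g            ∎
    where open HomReasoning

module _ {o ℓ e o′ ℓ′ e′ : Level}
         {W : Category o ℓ e} {V : Category o′ ℓ′ e′} {T : Terminal W}
         {U : Category.Obj V} (M : Multiplier W V T U) where
  open Category V
  open Multiplier M
  open Terminal T using (⊤)
  private
    module Hom {A B} = Setoid (hom-setoid V A B)

  DimSplit-∘⇒DimSplit : ∀ {A B} (φ : Hom B U) (χ : Hom A B) →
                        DimSplit (φ ∘ χ) → DimSplit φ
  DimSplit-∘⇒DimSplit φ χ (X , ψ , φχψ≈π₂) =
    X , χ ∘ ψ , Hom.trans (Hom.sym assoc) φχψ≈π₂

  SplitEpi⇒DimSplit : ∀ {A} (φ : Hom A U) → SplitEpi V φ → DimSplit φ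
  SplitEpi⇒DimSplit φ (s , φs≈id) = ⊤ , s ∘ π₂ ⊤ , cancel-section V (π₂ ⊤) φs≈id

  DimSplit-id : DimSplit (id {U})
  DimSplit-id = SplitEpi⇒DimSplit id (id , identityˡ)

  DimSplit-∘-SplitEpi : ∀ {A B} (φ : Hom B U) (χ : Hom A B) →
                        DimSplit φ → SplitEpi V χ → DimSplit (φ ∘ χ)
  DimSplit-∘-SplitEpi φ χ (X , ψ , φψ≈π₂) (s , χs≈id) = X , s ∘ ψ , (begin
    (φ ∘ χ) ∘ (s ∘ ψ)  ≈⟨ assoc ⟩
    φ ∘ (χ ∘ (s ∘ ψ))  ≈⟨ ∘-resp-≈ Hom.refl (cancel-section V ψ χs≈id) ⟩
    φ ∘ ψ              ≈⟨ φψ≈π₂ ⟩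
    π₂ X               ∎)
    where open HomReasoning V

  NonSpooky⇒DimSplit⇒SplitEpi : NonSpooky → ∀ {A} (φ : Hom A U) →
                                DimSplit φ → SplitEpi V φ
  NonSpooky⇒DimSplit⇒SplitEpi nonSpooky φ (X , χ , φχ≈π₂) with nonSpooky X
  ... | t , π₂t≈id = χ ∘ t , (begin
    φ ∘ (χ ∘ t)  ≈⟨ Hom.sym assoc ⟩
    (φ ∘ χ) ∘ t  ≈⟨ ∘-resp-≈ φχ≈π₂ Hom.refl ⟩
    π₂ X ∘ t     ≈⟨ π₂t≈id ⟩
    id           ∎)
    where open HomReasoning V

mainTheorem7 : ∀ {o ℓ e o′ ℓ′ e′ : Level}
    (W : Category o ℓ e) (V : Category o′ ℓ′ e′) (T : Terminal W)
    (U : Category.Obj V) (M : Multiplier W V T U) →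
    let open Category V
        open Multiplier M
    in
    -- (1)
    (∀ {A B} (φ : Hom B U) (χ : Hom A B) → DimSplit (φ ∘ χ) → DimSplit φ)
    -- (2)
    × DimSplit (id {U})
    -- (3)
    × (∀ {A B} (φ : Hom B U) (χ : Hom A B) → DimSplit φ → SplitEpi V χ → DimSplit (φ ∘ χ))
    -- (4)
    × (∀ {A} (φ : Hom A U) → SplitEpi V φ → DimSplit φ)
    -- (5)
    × (NonSpooky → ∀ {A} (φ : Hom A U) → DimSplit φ → SplitEpi V φ)
mainTheorem7 W V T U M =
    DimSplit-∘⇒DimSplit M
  , DimSplit-id M
  , DimSplit-∘-SplitEpi M
  , SplitEpi⇒DimSplit M
  , NonSpooky⇒DimSplit⇒SplitEpi M
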